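{- Let $M$ be a binary $m\times n$ matrix such that (i) there do not exist three distinct rows $r_a,r_b,r_c$ whose sets $S_a,S_b,S_c$ are pairwise intersecting and satisfy either (H1) $S_a\cap S_b\cap S_c=\emptyset$ or (H2) none of $S_a,S_b,S_c$ is contained in the union of the other two; (ii) there do not exist two columns $c_i,c_j$ such that $G(M)[vert(c_i)\cup vert(c_j)]$ contains an induced cycle on four vertices; and (iii) there is no maximal clique $Q$ of $G(M)$ such that no column $c_l$ satisfies $vert(c_l)=Q$. Then for each maximal clique $Q$ of $G(M)$ there is a column $c_p$ with $Q=vert(c_p)$. Further, with $\widetilde{M}=\begin{pmatrix} I_n \\ M\end{pmatrix}$, the matrix $\widetilde{M}$ is the clique matrix of $G(\widetilde{M})$.
   Context: $I_n$ is the $n\times n$ identity matrix. For a binary matrix $N$ with rows $r_1,\dots,r_p$ and columns $c_1,\dots,c_q$: $S_i=\{j : N_{ij}=1\}$; the derived graph $G(N)$ has vertex set $\{v_1,\dots,v_p\}$ and an edge $\{v_i,v_j\}$ ($i\ne j$) whenever some column $c_k$ has $N_{ik}=N_{jk}=1$; $vert(c_k)=\{v_i : N_{ik}=1\}$. $G[X]$ denotes the induced subgraph on $X$. $N$ is the clique matrix of $G(N)$ if the sets $vert(c_1),\dots,vert(c_q)$ are exactly the maximal cliques of $G(N)$, each appearing once. Sets are pairwise intersecting if every two have nonempty intersection. -}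

module Defs where

open import Data.Bool using (Bool; true; false)
open import Data.Nat using (ℕ; _+_)
open import Data.Fin using (Fin; splitAt)
open import Data.Fin.Properties using (_≟_)
open import Data.Fin.Subset using (Subset; _∈_; _⊆_; _∩_; _∪_; Empty; Nonempty)
open import Data.Vec using (tabulate)
open import Data.Sum using (_⊎_; inj₁; inj₂)
open import Data.Product using (_×_; ∃; ∃-syntax)
open import Relation.Nullary using (¬_)
open import Relation.Nullary.Decidable using (⌊_⌋)
open import Relation.Binary.PropositionalEquality using (_≡_; _≢_)

BinMatrix : ℕ → ℕ → Set
BinMatrix p q = Fin p → Fin q → Bool

rowSet : ∀ {p q} → BinMatrix p q → Fin p → Subset q
rowSet N i = tabulate (λ j → N i j)

vert : ∀ {p q} → BinMatrix p q → Fin q → Subset p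
vert N k = tabulate (λ i → N i k)

Adj : ∀ {p q} → BinMatrix p q → Fin p → Fin p → Set
Adj N i j = i ≢ j × ∃[ k ] (N i k ≡ true × N j k ≡ true)

IsClique : ∀ {p q} → BinMatrix p q → Subset p → Set
IsClique N Q = ∀ i j → i ∈ Q → j ∈ Q → i ≢ j → Adj N i j

IsMaximalClique : ∀ {p q} → BinMatrix p q → Subset p → Set
IsMaximalClique N Q = IsClique N Q × (∀ Q′ → IsClique N Q′ → Q ⊆ Q′ → Q′ ⊆ Q)

IsCliqueMatrix : ∀ {p q} → BinMatrix p q → Set
IsCliqueMatrix N =
  (∀ k → IsMaximalClique N (vert N k)) ×
  (∀ Q → IsMaximalClique N Q → ∃[ k ] (Q ≡ vert N k)) ×
  (∀ k l → vert N k ≡ vert N l → k ≡ l)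

PairwiseIntersecting₃ : ∀ {n} → Subset n → Subset n → Subset n → Set
PairwiseIntersecting₃ A B C = Nonempty (A ∩ B) × Nonempty (A ∩ C) × Nonempty (B ∩ C)

H1 : ∀ {n} → Subset n → Subset n → Subset n → Set
H1 A B C = Empty (A ∩ B ∩ C)

H2 : ∀ {n} → Subset n → Subset n → Subset n → Set
H2 A B C = ¬ (A ⊆ B ∪ C) × ¬ (B ⊆ A ∪ C) × ¬ (C ⊆ A ∪ B)

Cond-i : ∀ {m n} → BinMatrix m n → Set
Cond-i M = ¬ (∃[ a ] ∃[ b ] ∃[ c ]
  (a ≢ b × a ≢ c × b ≢ c ×
   PairwiseIntersecting₃ (rowSet M a) (rowSet M b) (rowSet M c) ×
   (H1 (rowSet M a) (rowSet M b) (rowSet M c) ⊎ H2 (rowSet M a) (rowSet M b) (rowSet M c))))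

HasInducedC4 : ∀ {p q} → BinMatrix p q → Subset p → Set
HasInducedC4 N X = ∃[ a ] ∃[ b ] ∃[ c ] ∃[ d ]
  (a ∈ X × b ∈ X × c ∈ X × d ∈ X ×
   a ≢ b × a ≢ c × a ≢ d × b ≢ c × b ≢ d × c ≢ d ×
   Adj N a b × Adj N b c × Adj N c d × Adj N d a ×
   ¬ Adj N a c × ¬ Adj N b d)

Cond-ii : ∀ {m n} → BinMatrix m n → Set
Cond-ii M = ¬ (∃[ i ] ∃[ j ] HasInducedC4 M (vert M i ∪ vert M j))

Cond-iii : ∀ {m n} → BinMatrix m n → Set
Cond-iii M = ¬ (∃[ Q ] (IsMaximalClique M Q × (∀ l → vert M l ≢ Q)))

stackId : ∀ {m n} → BinMatrix m n → BinMatrix (n + m) n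
stackId {m} {n} M r k with splitAt n r
... | inj₁ i = ⌊ i ≟ k ⌋
... | inj₂ i = M i k

module Submission where

-- Part one is the contrapositive of condition (iii): there are finitely many
-- columns and subset equality is decidable, so some column has vertex set Q.
--
-- For part two write N = (I_n ; M), with identity rows e k and M-rows r i.
-- The identity row e k meets only column k, so its closed neighbourhood in
-- G(N) is exactly vert N k.  Two general facts about derived graphs then do
-- the work: a clique containing the closed neighbourhood of one of its
-- vertices is maximal, and every clique through a vertex v lies inside
-- every set containing the closed neighbourhood of v.  Hence every column of
-- N is a maximal clique, every maximal clique through some e k is the column
-- k, and distinct columns differ (e k lies in column k only).  A maximal
-- clique Q of G(N) avoiding all e k consists of M-rows; it restricts to a
-- maximal clique of G(M), which by part one is a column p of M, and then Q
-- is contained in, hence equal to, the column p of N.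

open import Defs
open import Data.Nat using (_+_)
open import Data.Product using (_×_; _,_; proj₁; proj₂; ∃-syntax)
open import Data.Sum using (inj₁; inj₂)
open import Data.Bool using (Bool; true; false)
import Data.Bool.Properties as Bool
open import Data.Fin using (Fin; splitAt; _↑ˡ_; _↑ʳ_)
open import Data.Fin.Properties
  using (_≟_; any?; splitAt-↑ˡ; splitAt-↑ʳ; splitAt⁻¹-↑ˡ; splitAt⁻¹-↑ʳ;
         ↑ʳ-injective)
open import Data.Fin.Subset using (Subset; _∈_; _∉_; _⊆_; ⊥)
open import Data.Fin.Subset.Properties using (⊆-antisym; _∈?_)
open import Data.Vec using (tabulate; lookup; _++_)
open import Data.Vec.Properties
  using (≡-dec; []=⇒lookup; lookup⇒[]=; lookup∘tabulate;
         lookup-++ˡ; lookup-++ʳ; lookup-replicate)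
open import Data.Empty using (⊥-elim)
open import Relation.Nullary using (yes; no)
open import Relation.Nullary.Decidable using (⌊_⌋)
open import Relation.Binary.PropositionalEquality
  using (_≡_; refl; sym; trans; cong; subst)

∈-tabulate⁻ : ∀ {k} {f : Fin k → Bool} {x} → x ∈ tabulate f → f x ≡ true
∈-tabulate⁻ {f = f} {x} x∈ = trans (sym (lookup∘tabulate f x)) ([]=⇒lookup x∈)

∈-tabulate⁺ : ∀ {k} {f : Fin k → Bool} {x} → f x ≡ true → x ∈ tabulate f
∈-tabulate⁺ {f = f} {x} fx = lookup⇒[]= x _ (trans (lookup∘tabulate f x) fx)

module _ {p q} (N : BinMatrix p q) where

  column-clique : ∀ k → IsClique N (vert N k)
  column-clique k x y x∈ y∈ x≢y = x≢y , k , ∈-tabulate⁻ x∈ , ∈-tabulate⁻ y∈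

  ContainsClosedNbhd : Fin p → Subset p → Set
  ContainsClosedNbhd v C = v ∈ C × (∀ x → Adj N v x → x ∈ C)

  -- A clique through v consists of v and neighbours of v.
  clique⊆closedNbhd : ∀ {Q C v} → IsClique N Q → v ∈ Q →
    ContainsClosedNbhd v C → Q ⊆ C
  clique⊆closedNbhd {v = v} isClique v∈Q (v∈C , nbhd⊆C) {x} x∈Q with x ≟ v
  ... | yes refl = v∈C
  ... | no x≢v = nbhd⊆C x (isClique v x v∈Q x∈Q (λ v≡x → x≢v (sym v≡x)))

  closedNbhd-clique-maximal : ∀ {C v} → IsClique N C →
    ContainsClosedNbhd v C → IsMaximalClique N C
  closedNbhd-clique-maximal isClique nbhd =
    isClique , λ Q′ isClique′ C⊆Q′ →
      clique⊆closedNbhd isClique′ (C⊆Q′ (proj₁ nbhd)) nbhd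

  maximal-⊆-clique : ∀ {Q C} → IsMaximalClique N Q → IsClique N C →
    Q ⊆ C → Q ≡ C
  maximal-⊆-clique (_ , maximal) isClique Q⊆C =
    ⊆-antisym Q⊆C (maximal _ isClique Q⊆C)

columns-of-cond-iii : ∀ {m n} (M : BinMatrix m n) → Cond-iii M →
  ∀ Q → IsMaximalClique M Q → ∃[ p ] (Q ≡ vert M p)
columns-of-cond-iii M cond-iii Q maximal
  with any? (λ p → ≡-dec Bool._≟_ Q (vert M p))
... | yes column = column
... | no noColumn =
  ⊥-elim (cond-iii (Q , maximal , λ l eq → noColumn (l , sym eq)))

module Stacked {m n} (M : BinMatrix m n) where

  N : BinMatrix (n + m) n
  N = stackId M

  e : Fin n → Fin (n + m)
  e k = k ↑ˡ m

  r : Fin m → Fin (n + m)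
  r i = n ↑ʳ i

  stack-e : ∀ k l → N (e k) l ≡ ⌊ k ≟ l ⌋
  stack-e k l rewrite splitAt-↑ˡ n k m = refl

  stack-r : ∀ i l → N (r i) l ≡ M i l
  stack-r i l rewrite splitAt-↑ʳ n m i = refl

  data RowView : Fin (n + m) → Set where
    identity-row : ∀ k → RowView (e k)
    M-row        : ∀ i → RowView (r i)

  row-view : ∀ x → RowView x
  row-view x with splitAt n x in eq
  ... | inj₁ k = subst RowView (splitAt⁻¹-↑ˡ eq) (identity-row k)
  ... | inj₂ i = subst RowView (splitAt⁻¹-↑ʳ eq) (M-row i)

  e∈column : ∀ k → e k ∈ vert N k
  e∈column k = ∈-tabulate⁺ (trans (stack-e k k) (dec-refl k))
    where
    dec-refl : ∀ k → ⌊ k ≟ k ⌋ ≡ true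
    dec-refl k with k ≟ k
    ... | yes _ = refl
    ... | no k≢k = ⊥-elim (k≢k refl)

  e∈column⁻ : ∀ {k l} → e k ∈ vert N l → k ≡ l
  e∈column⁻ {k} {l} ek∈ = dec-true⁻ (trans (sym (stack-e k l)) (∈-tabulate⁻ ek∈))
    where
    dec-true⁻ : ⌊ k ≟ l ⌋ ≡ true → k ≡ l
    dec-true⁻ _ with k ≟ l
    dec-true⁻ _  | yes k≡l = k≡l
    dec-true⁻ () | no _

  e-closedNbhd : ∀ k → ContainsClosedNbhd N (e k) (vert N k)
  e-closedNbhd k = e∈column k , neighbour∈column
    where
    neighbour∈column : ∀ x → Adj N (e k) x → x ∈ vert N k
    neighbour∈column x (_ , c , ek∈c , x∈c)
      with e∈column⁻ (∈-tabulate⁺ {f = λ y → N y c} ek∈c)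
    ... | refl = ∈-tabulate⁺ x∈c

  columns-maximal : ∀ k → IsMaximalClique N (vert N k)
  columns-maximal k = closedNbhd-clique-maximal N (column-clique N k) (e-closedNbhd k)

  columns-distinct : ∀ k l → vert N k ≡ vert N l → k ≡ l
  columns-distinct k l eq = e∈column⁻ (subst (e k ∈_) eq (e∈column k))

  column-r : ∀ {i p} → i ∈ vert M p → r i ∈ vert N p
  column-r {i} {p} i∈p = ∈-tabulate⁺ (trans (stack-r i p) (∈-tabulate⁻ i∈p))

  adj-r⁺ : ∀ {i j} → Adj M i j → Adj N (r i) (r j)
  adj-r⁺ {i} {j} (i≢j , c , i∈c , j∈c) =
    (λ eq → i≢j (↑ʳ-injective n i j eq)) , c ,
    trans (stack-r i c) i∈c , trans (stack-r j c) j∈c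

  adj-r⁻ : ∀ {i j} → Adj N (r i) (r j) → Adj M i j
  adj-r⁻ {i} {j} (ri≢rj , c , i∈c , j∈c) =
    (λ eq → ri≢rj (cong r eq)) , c ,
    trans (sym (stack-r i c)) i∈c , trans (sym (stack-r j c)) j∈c

  restrict : Subset (n + m) → Subset m
  restrict Q = tabulate (λ i → lookup Q (r i))

  ∈-restrict⁺ : ∀ {Q i} → r i ∈ Q → i ∈ restrict Q
  ∈-restrict⁺ ri∈Q = ∈-tabulate⁺ ([]=⇒lookup ri∈Q)

  ∈-restrict⁻ : ∀ {Q i} → i ∈ restrict Q → r i ∈ Q
  ∈-restrict⁻ {Q} {i} i∈ = lookup⇒[]= (r i) Q (∈-tabulate⁻ i∈)

  lift : Subset m → Subset (n + m)
  lift Q′ = ⊥ {n} ++ Q′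

  lift-r : ∀ Q′ i → lookup (lift Q′) (r i) ≡ lookup Q′ i
  lift-r Q′ = lookup-++ʳ (⊥ {n}) Q′

  lift-e : ∀ Q′ k → lookup (lift Q′) (e k) ≡ false
  lift-e Q′ k = trans (lookup-++ˡ (⊥ {n}) Q′ k) (lookup-replicate k false)

  ∈-lift⁺ : ∀ {Q′ i} → i ∈ Q′ → r i ∈ lift Q′
  ∈-lift⁺ {Q′} {i} i∈ = lookup⇒[]= (r i) (lift Q′) (trans (lift-r Q′ i) ([]=⇒lookup i∈))

  lift-members : ∀ {Q′ x} → x ∈ lift Q′ → ∃[ i ] (x ≡ r i × i ∈ Q′)
  lift-members {Q′} {x} x∈ with row-view x
  ... | M-row i = i , refl , lookup⇒[]= i Q′ (trans (sym (lift-r Q′ i)) ([]=⇒lookup x∈))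
  ... | identity-row k with trans (sym (lift-e Q′ k)) ([]=⇒lookup x∈)
  ...   | ()

  NoIdentityRow : Subset (n + m) → Set
  NoIdentityRow Q = ∀ k → e k ∉ Q

  M-rows : ∀ {Q x} → NoIdentityRow Q → x ∈ Q → ∃[ i ] (x ≡ r i)
  M-rows {x = x} noE x∈Q with row-view x
  ... | identity-row k = ⊥-elim (noE k x∈Q)
  ... | M-row i = i , refl

  restrict-clique : ∀ {Q} → IsClique N Q → IsClique M (restrict Q)
  restrict-clique isClique i j i∈ j∈ i≢j =
    adj-r⁻ (isClique (r i) (r j) (∈-restrict⁻ i∈) (∈-restrict⁻ j∈)
      (λ eq → i≢j (↑ʳ-injective n i j eq)))

  lift-clique : ∀ {Q′} → IsClique M Q′ → IsClique N (lift Q′)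
  lift-clique isClique x y x∈ y∈ x≢y with lift-members x∈ | lift-members y∈
  ... | i , refl , i∈ | j , refl , j∈ =
    adj-r⁺ (isClique i j i∈ j∈ (λ eq → x≢y (cong r eq)))

  restrict-maximal : ∀ {Q} → NoIdentityRow Q → IsMaximalClique N Q →
    IsMaximalClique M (restrict Q)
  restrict-maximal {Q} noE (isClique , maximal) =
    restrict-clique isClique , λ Q′ isClique′ restrictQ⊆Q′ i∈Q′ →
      ∈-restrict⁺ (maximal (lift Q′) (lift-clique isClique′)
                             (Q⊆lift restrictQ⊆Q′) (∈-lift⁺ i∈Q′))
    where
    Q⊆lift : ∀ {Q′} → restrict Q ⊆ Q′ → Q ⊆ lift Q′
    Q⊆lift restrictQ⊆Q′ x∈Q with M-rows noE x∈Q
    ... | i , refl = ∈-lift⁺ (restrictQ⊆Q′ (∈-restrict⁺ x∈Q))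

  maximal-cliques-are-columns : Cond-iii M →
    ∀ Q → IsMaximalClique N Q → ∃[ k ] (Q ≡ vert N k)
  maximal-cliques-are-columns cond-iii Q maximal with any? (λ k → e k ∈? Q)
  ... | yes (k , ek∈Q) =
    k , maximal-⊆-clique N maximal (column-clique N k)
          (clique⊆closedNbhd N (proj₁ maximal) ek∈Q (e-closedNbhd k))
  ... | no noIdentity =
    p , maximal-⊆-clique N maximal (column-clique N p) Q⊆column
    where
    noE : NoIdentityRow Q
    noE k ek∈Q = noIdentity (k , ek∈Q)
    column : ∃[ p ] (restrict Q ≡ vert M p)
    column = columns-of-cond-iii M cond-iii (restrict Q) (restrict-maximal noE maximal)
    p : Fin n
    p = proj₁ column
    Q⊆column : Q ⊆ vert N p
    Q⊆column x∈Q with M-rows noE x∈Q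
    ... | i , refl = column-r (subst (i ∈_) (proj₂ column) (∈-restrict⁺ x∈Q))

  clique-matrix : Cond-iii M → IsCliqueMatrix N
  clique-matrix cond-iii =
    columns-maximal , maximal-cliques-are-columns cond-iii , columns-distinct

lemma9 : ∀ {m n} (M : BinMatrix m n) →
    Cond-i M → Cond-ii M → Cond-iii M →
    (∀ Q → IsMaximalClique M Q → ∃[ p ] (Q ≡ vert M p)) ×
    IsCliqueMatrix (stackId M)
lemma9 M _ _ cond-iii =
  columns-of-cond-iii M cond-iii , Stacked.clique-matrix M cond-iii
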